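{- Let $S$ and $T$ be sets of surreals with $u < v$ for all $u\in S$, $v \in T$. Let $s = \sup^* S$, $t = \inf^* T$, $\alpha = \ell(s)$, $\beta = \ell(t)$, $\varepsilon = \max\{\alpha,\beta\}$. Let $\hat s$ be the prolongment of $s$ to length $\varepsilon+1$ obtained by adding only minuses (i.e. $\hat s(\gamma) = -$ for $\alpha \leq \gamma \leq \varepsilon$), and $\hat t$ the prolongment of $t$ to length $\varepsilon+1$ obtained by adding only pluses. Then both $\hat s$ and $\hat t$ separate $S$ and $T$, and $\hat s < \hat t$. Moreover, if $\gamma$ is the least ordinal such that $\hat s(\gamma) \neq \hat t(\gamma)$, then $\hat s_{\restriction\gamma} = \hat t_{\restriction\gamma}$ is the shortest surreal separating $S$ and $T$, and every surreal separating $S$ and $T$ is a prolongment of $\hat s_{\restriction\gamma}$.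
   Context: A surreal is a function $s$ from some ordinal $\ell(s)$ (its length, possibly $0$) to $\{+,-\}$; for $\gamma \geq \ell(s)$, $s(\gamma)$ is called undefined. "$s(\gamma)=t(\gamma)$" means both undefined or both defined and equal. Order: for distinct $s,t$, with $\gamma$ least such that $s(\gamma)\neq t(\gamma)$, $s<t$ iff $s(\gamma)<t(\gamma)$ in the ordering $- < \text{undefined} < +$. For $\gamma \leq \ell(s)$, $s_{\restriction\gamma}$ is the surreal of length $\gamma$ agreeing with $s$ below $\gamma$; for $\gamma > \ell(s)$, $s_{\restriction\gamma}=s$; $s_{\restriction\leq\gamma} := s_{\restriction(\gamma+1)}$. A surreal $w$ is a prolongment of $t$ if $t = w_{\restriction\gamma}$ for some ordinal $\gamma$. For a surreal $u$ of length $\beta$, $u^\frown +$ (resp. $u^\frown -$) is the surreal of length $\beta+1$ extending $u$ with value $+$ (resp. $-$) at $\beta$. For a set $S$ of surreals: if $S$ has a maximum $u$, $\sup^* S = u^\frown +$; otherwise $\sup^* S$ is the surreal $s$ such that $s(\gamma)$ is defined iff there is $u \in S$ with $u(\gamma)$ defined and $u'_{\restriction\leq\gamma} = u_{\restriction\leq\gamma}$ for all $u'\in S$ with $u'\geq u$, in which case $s(\gamma)=u(\gamma)$. Symmetrically, for a set $T$: if $T$ has a minimum $v$, $\inf^* T = v^\frown -$; otherwise $\inf^* T$ is the surreal $t$ such that $t(\gamma)$ is defined iff there is $v \in T$ with $v(\gamma)$ defined and $v'_{\restriction\leq\gamma} = v_{\restriction\leq\gamma}$ for all $v'\in T$ with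 $v'\leq v$, in which case $t(\gamma)=v(\gamma)$. A surreal $w$ separates $S$ and $T$ if $u < w < v$ for all $u\in S$, $v\in T$. -}

module Defs where

open import Level using (0ℓ)
open import Data.Product using (Σ; _×_; _,_; proj₁; ∃)
open import Data.Sum using (_⊎_; inj₁; inj₂)
open import Relation.Nullary using (¬_)
open import Relation.Binary.PropositionalEquality using (_≡_; _≢_)
open import Relation.Binary.Core using (Rel)
open import Relation.Binary.Definitions using (tri<; tri≈; tri>)
open import Relation.Binary.Structures using (IsStrictTotalOrder)
open import Induction.WellFounded using (WellFounded)

-- An abstract class of "ordinals": a well-ordered set (well-founded strict
-- total order) with a least element and an immediate successor of every
-- element.  (Classically: any limit ordinal > 0, viewed as its set of
-- smaller ordinals.)  Surreals are then sign sequences whose length lies in it.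
record Ordinals : Set₁ where
  field
    Ord       : Set
    _<_       : Rel Ord 0ℓ
    isSTO     : IsStrictTotalOrder _≡_ _<_
    wf        : WellFounded _<_
    zero      : Ord
    zero-min  : ∀ γ → ¬ (γ < zero)
    sucO      : Ord → Ord
    suc-inc   : ∀ γ → γ < sucO γ
    suc-least : ∀ γ δ → γ < δ → (sucO γ < δ ⊎ sucO γ ≡ δ)

data Sign : Set where
  minus plus : Sign

data ESign : Set where
  eminus undef eplus : ESign

data _<ₑ_ : ESign → ESign → Set where
  m<u : eminus <ₑ undef
  m<p : eminus <ₑ eplus
  u<p : undef <ₑ eplus

embed : Sign → ESign
embed minus = eminus
embed plus  = eplus

module Surreals (O : Ordinals) where
  open Ordinals O public
  open IsStrictTotalOrder isSTO using (compare)

  _≤O_ : Ord → Ord → Set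
  a ≤O b = a < b ⊎ a ≡ b

  maxO : Ord → Ord → Ord
  maxO a b with compare a b
  ... | tri< _ _ _ = b
  ... | tri≈ _ _ _ = a
  ... | tri> _ _ _ = a

  minO : Ord → Ord → Ord
  minO a b with compare a b
  ... | tri< _ _ _ = a
  ... | tri≈ _ _ _ = a
  ... | tri> _ _ _ = b

  -- A surreal: a length and the signs; only the values below the length matter.
  record Surreal : Set where
    constructor mkS
    field
      len : Ord
      sgn : Ord → Sign
  open Surreal public

  val : Surreal → Ord → ESign
  val s γ with compare γ (len s)
  ... | tri< _ _ _ = embed (sgn s γ)
  ... | tri≈ _ _ _ = undef
  ... | tri> _ _ _ = undef

  _≈_ : Surreal → Surreal → Set
  s ≈ t = ∀ γ → val s γ ≡ val t γ

  _<ₛ_ : Surreal → Surreal → Set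
  s <ₛ t = Σ Ord λ γ → (∀ δ → δ < γ → val s δ ≡ val t δ) × (val s γ <ₑ val t γ)

  _≤ₛ_ : Surreal → Surreal → Set
  s ≤ₛ t = s <ₛ t ⊎ s ≈ t

  restrict : Surreal → Ord → Surreal
  restrict s γ = mkS (minO γ (len s)) (sgn s)

  restrict≤ : Surreal → Ord → Surreal
  restrict≤ s γ = restrict s (sucO γ)

  Prolongment : Surreal → Surreal → Set
  Prolongment w t = Σ Ord λ γ → t ≈ restrict w γ

  append : Surreal → Sign → Surreal
  append u σ = mkS (sucO (len u)) f
    where
    f : Ord → Sign
    f δ with compare δ (len u)
    ... | tri< _ _ _ = sgn u δ
    ... | tri≈ _ _ _ = σ
    ... | tri> _ _ _ = σ

  SetS : Set₁
  SetS = Surreal → Set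

  IsMax : SetS → Surreal → Set
  IsMax S u = S u × (∀ u' → S u' → u' ≤ₛ u)

  IsMin : SetS → Surreal → Set
  IsMin T v = T v × (∀ v' → T v' → v ≤ₛ v')

  -- witness that s(γ) is defined in the definition of sup* (no-maximum case)
  SupWit : SetS → Surreal → Ord → Set
  SupWit S u γ = S u × (val u γ ≢ undef)
    × (∀ u' → S u' → u ≤ₛ u' → restrict≤ u' γ ≈ restrict≤ u γ)

  InfWit : SetS → Surreal → Ord → Set
  InfWit T v γ = T v × (val v γ ≢ undef)
    × (∀ v' → T v' → v' ≤ₛ v → restrict≤ v' γ ≈ restrict≤ v γ)

  IsSupStar : SetS → Surreal → Set
  IsSupStar S s =
      (Σ Surreal λ u → IsMax S u × s ≈ append u plus)
    ⊎ ((¬ Σ Surreal (IsMax S)) ×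
       (∀ γ → ((val s γ ≡ undef) × ¬ Σ Surreal (λ u → SupWit S u γ))
            ⊎ Σ Surreal (λ u → SupWit S u γ × val s γ ≡ val u γ)))

  IsInfStar : SetS → Surreal → Set
  IsInfStar T t =
      (Σ Surreal λ v → IsMin T v × t ≈ append v minus)
    ⊎ ((¬ Σ Surreal (IsMin T)) ×
       (∀ γ → ((val t γ ≡ undef) × ¬ Σ Surreal (λ v → InfWit T v γ))
            ⊎ Σ Surreal (λ v → InfWit T v γ × val t γ ≡ val v γ)))

  Separates : SetS → SetS → Surreal → Set
  Separates S T w = (∀ u → S u → u <ₛ w) × (∀ v → T v → w <ₛ v)

  prolongTo : Surreal → Ord → Sign → Surreal
  prolongTo s ε σ = mkS (sucO ε) f
    where
    f : Ord → Sign
    f δ with compare δ (len s)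
    ... | tri< _ _ _ = sgn s δ
    ... | tri≈ _ _ _ = σ
    ... | tri> _ _ _ = σ

  LeastDiff : Surreal → Surreal → Ord → Set
  LeastDiff a b γ = (val a γ ≢ val b γ) × (∀ δ → δ < γ → val a δ ≡ val b δ)

{-# OPTIONS --safe #-}
module Submission where

-- Every u ∈ S lies below s, and at the first place where
-- u and s differ s carries a plus (if S has no maximum, this is the first
-- place where elements of S above u depart from u); conversely, a surreal
-- that agrees with s up to a defined place and is smaller there lies at or
-- below some element of S.  Negating all signs gives the dual facts for
-- t = inf* T, and all of them survive prolonging s by minuses and t by
-- pluses.  Now ŝ and t̂ have the same length and ŝ(ε) = - ≠ + = t̂(ε), so
-- they first differ at some γ.  There ŝ(γ) = + and t̂(γ) = - is impossible:
-- the common restriction c = ŝ↾γ would lie at or below an element of S and at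
-- or above an element of T.  Hence ŝ(γ) = -, t̂(γ) = +, and the bounds above show that ŝ,
-- t̂ and c all separate S and T.  Finally, a separator w agrees with ŝ below
-- γ: at the least place where it does not, w would be bounded by S or T.

open import Defs
open import Level using (0ℓ)
open import Axiom.ExcludedMiddle using (ExcludedMiddle)
open import Data.Product using (Σ; _×_; _,_; proj₁; proj₂)
open import Data.Sum using (_⊎_; inj₁; inj₂; [_,_]) renaming (map to ⊎-map)
open import Data.Empty using (⊥; ⊥-elim)
open import Function using (id)
open import Relation.Nullary using (¬_; yes; no)
open import Relation.Nullary.Decidable using (decidable-stable)
open import Relation.Binary.PropositionalEquality
  using (_≡_; _≢_; refl; sym; trans; cong; subst; subst₂)
open import Relation.Binary.Definitions
  using (DecidableEquality; Trichotomous; tri<; tri≈; tri>)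
open import Relation.Binary.Structures using (IsStrictTotalOrder)
open import Induction.WellFounded using (WfRec)
import Induction.WellFounded as WF

_≟ₑ_ : DecidableEquality ESign
eminus ≟ₑ eminus = yes refl
eminus ≟ₑ undef  = no λ ()
eminus ≟ₑ eplus  = no λ ()
undef  ≟ₑ eminus = no λ ()
undef  ≟ₑ undef  = yes refl
undef  ≟ₑ eplus  = no λ ()
eplus  ≟ₑ eminus = no λ ()
eplus  ≟ₑ undef  = no λ ()
eplus  ≟ₑ eplus  = yes refl

≡ₑ-stable : ∀ {a b : ESign} → ¬ a ≢ b → a ≡ b
≡ₑ-stable {a} {b} = decidable-stable (a ≟ₑ b)

<ₑ-irrefl : ∀ {a} → ¬ a <ₑ a
<ₑ-irrefl ()

<ₑ-cmp : Trichotomous _≡_ _<ₑ_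
<ₑ-cmp eminus eminus = tri≈ (λ ()) refl (λ ())
<ₑ-cmp eminus undef  = tri< m<u (λ ()) (λ ())
<ₑ-cmp eminus eplus  = tri< m<p (λ ()) (λ ())
<ₑ-cmp undef  eminus = tri> (λ ()) (λ ()) m<u
<ₑ-cmp undef  undef  = tri≈ (λ ()) refl (λ ())
<ₑ-cmp undef  eplus  = tri< u<p (λ ()) (λ ())
<ₑ-cmp eplus  eminus = tri> (λ ()) (λ ()) m<p
<ₑ-cmp eplus  undef  = tri> (λ ()) (λ ()) u<p
<ₑ-cmp eplus  eplus  = tri≈ (λ ()) refl (λ ())

<ₑ-trans : ∀ {a b c} → a <ₑ b → b <ₑ c → a <ₑ c
<ₑ-trans m<u u<p = m<p

≮ₑ-eminus : ∀ {a} → ¬ a <ₑ eminus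
≮ₑ-eminus ()

eplus-≮ₑ : ∀ {a} → ¬ eplus <ₑ a
eplus-≮ₑ ()

<ₑ-eplus : ∀ {a b} → a <ₑ b → a <ₑ eplus
<ₑ-eplus m<u = m<p
<ₑ-eplus m<p = m<p
<ₑ-eplus u<p = u<p

≢eminus⇒eminus<ₑ : ∀ {a} → a ≢ eminus → eminus <ₑ a
≢eminus⇒eminus<ₑ {eminus} a≢- = ⊥-elim (a≢- refl)
≢eminus⇒eminus<ₑ {undef}  _   = m<u
≢eminus⇒eminus<ₑ {eplus}  _   = m<p

<ₑ-defined⇒eplus : ∀ {a b} → a <ₑ b → b ≢ undef → b ≡ eplus
<ₑ-defined⇒eplus m<u b-def = ⊥-elim (b-def refl)
<ₑ-defined⇒eplus m<p _     = refl
<ₑ-defined⇒eplus u<p _     = refl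

undef-<ₑ : ∀ {b} → undef <ₑ b → b ≡ eplus
undef-<ₑ u<p = refl

≢eplus⇒≤undef : ∀ a → a ≢ eplus → a ≡ undef ⊎ a <ₑ undef
≢eplus⇒≤undef eminus _    = inj₂ m<u
≢eplus⇒≤undef undef  _    = inj₁ refl
≢eplus⇒≤undef eplus  a≢+ = ⊥-elim (a≢+ refl)

≢eplus⇒<ₑeplus : ∀ {a} → a ≢ eplus → a <ₑ eplus
≢eplus⇒<ₑeplus {eminus} _   = m<p
≢eplus⇒<ₑeplus {undef}  _   = u<p
≢eplus⇒<ₑeplus {eplus}  a≢+ = ⊥-elim (a≢+ refl)

eminus≢eplus : eminus ≢ eplus
eminus≢eplus ()

undef≢eminus : undef ≢ eminus
undef≢eminus ()

undef≢eplus : undef ≢ eplus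
undef≢eplus ()

opposite-signs : ∀ a b → a ≢ undef → b ≢ undef → a ≢ b →
                 (a ≡ eminus × b ≡ eplus) ⊎ (a ≡ eplus × b ≡ eminus)
opposite-signs undef  _      a-def _     _   = ⊥-elim (a-def refl)
opposite-signs _      undef  _     b-def _   = ⊥-elim (b-def refl)
opposite-signs eminus eminus _     _     a≢b = ⊥-elim (a≢b refl)
opposite-signs eminus eplus  _     _     _   = inj₁ (refl , refl)
opposite-signs eplus  eminus _     _     _   = inj₂ (refl , refl)
opposite-signs eplus  eplus  _     _     a≢b = ⊥-elim (a≢b refl)

embed≢undef : ∀ σ → embed σ ≢ undef
embed≢undef minus ()
embed≢undef plus  ()

flipSign : Sign → Sign
flipSign minus = plus
flipSign plus  = minus

eflip : ESign → ESign
eflip eminus = eplus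
eflip undef  = undef
eflip eplus  = eminus

embed-flipSign : ∀ σ → embed (flipSign σ) ≡ eflip (embed σ)
embed-flipSign minus = refl
embed-flipSign plus  = refl

eflip-involutive : ∀ a → eflip (eflip a) ≡ a
eflip-involutive eminus = refl
eflip-involutive undef  = refl
eflip-involutive eplus  = refl

eflip-injective : ∀ {a b} → eflip a ≡ eflip b → a ≡ b
eflip-injective {a} {b} e =
  trans (sym (eflip-involutive a)) (trans (cong eflip e) (eflip-involutive b))

eflip-<ₑ : ∀ {a b} → a <ₑ b → eflip b <ₑ eflip a
eflip-<ₑ m<u = u<p
eflip-<ₑ m<p = m<p
eflip-<ₑ u<p = m<u

eflip-<ₑ⁻ : ∀ {a b} → eflip a <ₑ eflip b → b <ₑ a
eflip-<ₑ⁻ {a} {b} lt =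
  subst₂ _<ₑ_ (eflip-involutive b) (eflip-involutive a) (eflip-<ₑ lt)

module SurrealBasics (O : Ordinals) where
  open Surreals O public
  open IsStrictTotalOrder isSTO using (compare; _<?_; irrefl)
    renaming (trans to <-trans)

  <-irrefl : ∀ {a} → ¬ a < a
  <-irrefl = irrefl refl

  ≤-<-trans : ∀ {a b c} → a ≤O b → b < c → a < c
  ≤-<-trans (inj₁ a<b) b<c = <-trans a<b b<c
  ≤-<-trans (inj₂ refl) b<c = b<c

  <-≤-trans : ∀ {a b c} → a < b → b ≤O c → a < c
  <-≤-trans a<b (inj₁ b<c) = <-trans a<b b<c
  <-≤-trans a<b (inj₂ refl) = a<b

  ≤O-trans : ∀ {a b c} → a ≤O b → b ≤O c → a ≤O c
  ≤O-trans (inj₁ a<b) b≤c = inj₁ (<-≤-trans a<b b≤c)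
  ≤O-trans (inj₂ refl) b≤c = b≤c

  ≤⇒≯ : ∀ {a b} → a ≤O b → ¬ b < a
  ≤⇒≯ a≤b b<a = <-irrefl (≤-<-trans a≤b b<a)

  <-trichotomy : ∀ a b → a < b ⊎ a ≡ b ⊎ b < a
  <-trichotomy a b with compare a b
  ... | tri< a<b _ _ = inj₁ a<b
  ... | tri≈ _ a≡b _ = inj₂ (inj₁ a≡b)
  ... | tri> _ _ b<a = inj₂ (inj₂ b<a)

  ≮⇒≥ : ∀ {a b} → ¬ a < b → b ≤O a
  ≮⇒≥ {a} {b} a≮b with compare a b
  ... | tri< a<b _ _ = ⊥-elim (a≮b a<b)
  ... | tri≈ _ a≡b _ = inj₂ (sym a≡b)
  ... | tri> _ _ b<a = inj₁ b<a

  <sucO⇒≤ : ∀ {a b} → a < sucO b → a ≤O b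
  <sucO⇒≤ {a} {b} a<sb with compare a b
  ... | tri< a<b _ _ = inj₁ a<b
  ... | tri≈ _ a≡b _ = inj₂ a≡b
  ... | tri> _ _ b<a with suc-least b a b<a
  ...   | inj₁ sb<a = ⊥-elim (<-irrefl (<-trans sb<a a<sb))
  ...   | inj₂ refl = ⊥-elim (<-irrefl a<sb)

  ≤⇒<sucO : ∀ {a b} → a ≤O b → a < sucO b
  ≤⇒<sucO a≤b = ≤-<-trans a≤b (suc-inc _)

  minO-≤ˡ : ∀ a b → minO a b ≤O a
  minO-≤ˡ a b with compare a b
  ... | tri< _ _ _ = inj₂ refl
  ... | tri≈ _ _ _ = inj₂ refl
  ... | tri> _ _ b<a = inj₁ b<a

  minO-≤ʳ : ∀ a b → minO a b ≤O b
  minO-≤ʳ a b with compare a b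
  ... | tri< a<b _ _ = inj₁ a<b
  ... | tri≈ _ a≡b _ = inj₂ a≡b
  ... | tri> _ _ _ = inj₂ refl

  <-minO : ∀ {q} a b → q < a → q < b → q < minO a b
  <-minO a b q<a q<b with compare a b
  ... | tri< _ _ _ = q<a
  ... | tri≈ _ _ _ = q<a
  ... | tri> _ _ _ = q<b

  maxO-≥ˡ : ∀ a b → a ≤O maxO a b
  maxO-≥ˡ a b with compare a b
  ... | tri< a<b _ _ = inj₁ a<b
  ... | tri≈ _ _ _ = inj₂ refl
  ... | tri> _ _ _ = inj₂ refl

  maxO-≥ʳ : ∀ a b → b ≤O maxO a b
  maxO-≥ʳ a b with compare a b
  ... | tri< _ _ _ = inj₂ refl
  ... | tri≈ _ a≡b _ = inj₂ (sym a≡b)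
  ... | tri> _ _ b<a = inj₁ b<a

  val-< : ∀ x {p} → p < len x → val x p ≡ embed (sgn x p)
  val-< x {p} p<l with compare p (len x)
  ... | tri< _ _ _ = refl
  ... | tri≈ p≮l _ _ = ⊥-elim (p≮l p<l)
  ... | tri> p≮l _ _ = ⊥-elim (p≮l p<l)

  val-≮ : ∀ x {p} → ¬ p < len x → val x p ≡ undef
  val-≮ x {p} p≮l with compare p (len x)
  ... | tri< p<l _ _ = ⊥-elim (p≮l p<l)
  ... | tri≈ _ _ _ = refl
  ... | tri> _ _ _ = refl

  <⇒defined : ∀ x {p} → p < len x → val x p ≢ undef
  <⇒defined x p<l e = embed≢undef _ (trans (sym (val-< x p<l)) e)

  defined⇒< : ∀ x {p} → val x p ≢ undef → p < len x
  defined⇒< x {p} x-def with p <? len x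
  ... | yes p<l = p<l
  ... | no p≮l = ⊥-elim (x-def (val-≮ x p≮l))

  val≡embed⇒defined : ∀ x {p σ} → val x p ≡ embed σ → val x p ≢ undef
  val≡embed⇒defined x e x-undef = embed≢undef _ (trans (sym e) x-undef)

  val≡embed⇒< : ∀ x {p σ} → val x p ≡ embed σ → p < len x
  val≡embed⇒< x e = defined⇒< x (val≡embed⇒defined x e)

  undefined-upward : ∀ x {p q} → val x p ≡ undef → p < q → val x q ≡ undef
  undefined-upward x x-undef p<q =
    val-≮ x (λ q<l → <⇒defined x (<-trans p<q q<l) x-undef)

  Agree : Surreal → Surreal → Ord → Set
  Agree x y δ = ∀ q → q < δ → val x q ≡ val y q

  Agree-sym : ∀ {x y δ} → Agree x y δ → Agree y x δ
  Agree-sym x~y q q<δ = sym (x~y q q<δ)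

  Agree-trans : ∀ {x y z δ} → Agree x y δ → Agree y z δ → Agree x z δ
  Agree-trans x~y y~z q q<δ = trans (x~y q q<δ) (y~z q q<δ)

  Agree-≤ : ∀ {x y δ δ′} → δ ≤O δ′ → Agree x y δ′ → Agree x y δ
  Agree-≤ δ≤δ′ x~y q q<δ = x~y q (<-≤-trans q<δ δ≤δ′)

  Agree-respʳ-≈ : ∀ {x y z δ} → y ≈ z → Agree x y δ → Agree x z δ
  Agree-respʳ-≈ y≈z x~y q q<δ = trans (x~y q q<δ) (y≈z q)

  agree-undefined⇒≈ : ∀ {x y δ} → Agree x y δ →
                      val x δ ≡ undef → val y δ ≡ undef → x ≈ y
  agree-undefined⇒≈ {x} {y} {δ} x~y x-undef y-undef q with compare q δ
  ... | tri< q<δ _ _ = x~y q q<δ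
  ... | tri≈ _ refl _ = trans x-undef (sym y-undef)
  ... | tri> _ _ δ<q =
    trans (undefined-upward x x-undef δ<q) (sym (undefined-upward y y-undef δ<q))

  ≈-refl : ∀ {x} → x ≈ x
  ≈-refl _ = refl

  ≈-sym : ∀ {x y} → x ≈ y → y ≈ x
  ≈-sym x≈y q = sym (x≈y q)

  ≈-trans : ∀ {x y z} → x ≈ y → y ≈ z → x ≈ z
  ≈-trans x≈y y≈z q = trans (x≈y q) (y≈z q)

  ≈-pointwise : ∀ {l f g} → (∀ δ → f δ ≡ g δ) → mkS l f ≈ mkS l g
  ≈-pointwise {l} f≗g γ with compare γ l
  ... | tri< _ _ _ = cong embed (f≗g γ)
  ... | tri≈ _ _ _ = refl
  ... | tri> _ _ _ = refl

  <ₛ-irrefl : ∀ {x} → ¬ x <ₛ x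
  <ₛ-irrefl (_ , _ , lt) = <ₑ-irrefl lt

  <ₛ-trans : ∀ {x y z} → x <ₛ y → y <ₛ z → x <ₛ z
  <ₛ-trans {x} {y} {z} (p , x~y , x<y) (q , y~z , y<z) with compare p q
  ... | tri< p<q _ _ =
    p , Agree-trans x~y (Agree-≤ (inj₁ p<q) y~z) , subst (val x p <ₑ_) (y~z p p<q) x<y
  ... | tri≈ _ refl _ = p , Agree-trans x~y y~z , <ₑ-trans x<y y<z
  ... | tri> _ _ q<p =
    q , Agree-trans (Agree-≤ (inj₁ q<p) x~y) y~z , subst (_<ₑ val z q) (sym (x~y q q<p)) y<z

  <ₛ-respˡ-≈ : ∀ {x x′ y} → x ≈ x′ → x <ₛ y → x′ <ₛ y
  <ₛ-respˡ-≈ {y = y} x≈x′ (p , x~y , x<y) =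
    p , Agree-trans (Agree-sym (λ q _ → x≈x′ q)) x~y , subst (_<ₑ val y p) (x≈x′ p) x<y

  <ₛ-respʳ-≈ : ∀ {x y y′} → y ≈ y′ → x <ₛ y → x <ₛ y′
  <ₛ-respʳ-≈ {x} y≈y′ (p , x~y , x<y) =
    p , Agree-respʳ-≈ y≈y′ x~y , subst (val x p <ₑ_) (y≈y′ p) x<y

  ≤ₛ-<ₛ-trans : ∀ {x y z} → x ≤ₛ y → y <ₛ z → x <ₛ z
  ≤ₛ-<ₛ-trans (inj₁ x<y) = <ₛ-trans x<y
  ≤ₛ-<ₛ-trans (inj₂ x≈y) = <ₛ-respˡ-≈ (≈-sym x≈y)

  ≤ₛ-trans : ∀ {x y z} → x ≤ₛ y → y ≤ₛ z → x ≤ₛ z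
  ≤ₛ-trans x≤y (inj₁ y<z) = inj₁ (≤ₛ-<ₛ-trans x≤y y<z)
  ≤ₛ-trans (inj₁ x<y) (inj₂ y≈z) = inj₁ (<ₛ-respʳ-≈ y≈z x<y)
  ≤ₛ-trans (inj₂ x≈y) (inj₂ y≈z) = inj₂ (≈-trans x≈y y≈z)

  ≤ₛ⇒≯ : ∀ {x y} → x ≤ₛ y → ¬ y <ₛ x
  ≤ₛ⇒≯ x≤y y<x = <ₛ-irrefl (≤ₛ-<ₛ-trans x≤y y<x)

  ≤ₛ-first-difference : ∀ {x y p} → x ≤ₛ y → Agree x y p →
                        val x p ≢ val y p → val x p <ₑ val y p
  ≤ₛ-first-difference {x} {y} {p} x≤y x~y x≢y with <ₑ-cmp (val x p) (val y p)
  ... | tri< x<y _ _ = x<y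
  ... | tri≈ _ x≡y _ = ⊥-elim (x≢y x≡y)
  ... | tri> _ _ y<x = ⊥-elim (≤ₛ⇒≯ x≤y (p , Agree-sym x~y , y<x))

  ≤ₛ-eplus : ∀ {x y p} → x ≤ₛ y → Agree x y p → val x p ≡ eplus → val y p ≡ eplus
  ≤ₛ-eplus {x} {y} {p} x≤y x~y x+ = ≡ₑ-stable λ y≢+ →
    eplus-≮ₑ (subst (_<ₑ val y p) x+
      (≤ₛ-first-difference x≤y x~y (λ x≡y → y≢+ (trans (sym x≡y) x+))))

  agree-≤ₛ : ∀ {x y δ} → Agree x y δ → val y δ ≡ undef → val x δ ≢ eplus → x ≤ₛ y
  agree-≤ₛ {x} {y} {δ} x~y y-undef x≢+ with ≢eplus⇒≤undef (val x δ) x≢+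
  ... | inj₁ x-undef = inj₂ (agree-undefined⇒≈ x~y x-undef y-undef)
  ... | inj₂ x<undef = inj₁ (δ , x~y , subst (val x δ <ₑ_) (sym y-undef) x<undef)

  val-restrict-< : ∀ x {m q} → q < m → val (restrict x m) q ≡ val x q
  val-restrict-< x {m} {q} q<m with q <? len x
  ... | yes q<l = trans (val-< (restrict x m) (<-minO m (len x) q<m q<l)) (sym (val-< x q<l))
  ... | no q≮l =
    trans (val-≮ (restrict x m) (λ q<min → q≮l (<-≤-trans q<min (minO-≤ʳ m (len x)))))
          (sym (val-≮ x q≮l))

  val-restrict-≮ : ∀ x {m q} → ¬ q < m → val (restrict x m) q ≡ undef
  val-restrict-≮ x {m} q≮m =
    val-≮ (restrict x m) (λ q<min → q≮m (<-≤-trans q<min (minO-≤ˡ m (len x))))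

  restrict-undefined : ∀ x {m} → val (restrict x m) m ≡ undef
  restrict-undefined x = val-restrict-≮ x <-irrefl

  restrict-agree : ∀ x {m} → Agree (restrict x m) x m
  restrict-agree x q q<m = val-restrict-< x q<m

  Agree⇒restrict≈ : ∀ {x y m} → Agree x y m → restrict x m ≈ restrict y m
  Agree⇒restrict≈ {x} {y} {m} x~y q with q <? m
  ... | yes q<m = trans (val-restrict-< x q<m) (trans (x~y q q<m) (sym (val-restrict-< y q<m)))
  ... | no q≮m = trans (val-restrict-≮ x q≮m) (sym (val-restrict-≮ y q≮m))

  restrict≈⇒Agree : ∀ {x y m} → restrict x m ≈ restrict y m → Agree x y m
  restrict≈⇒Agree {x} {y} x↾≈y↾ q q<m =
    trans (sym (val-restrict-< x q<m)) (trans (x↾≈y↾ q) (val-restrict-< y q<m))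

  val-prolong-< : ∀ x {ε σ p} → len x ≤O ε → p < len x → val (prolongTo x ε σ) p ≡ val x p
  val-prolong-< x {ε} {σ} {p} l≤ε p<l =
    trans (val-< (prolongTo x ε σ) (≤⇒<sucO (inj₁ (<-≤-trans p<l l≤ε))))
          (trans (cong embed sgn-prolong) (sym (val-< x p<l)))
    where
    sgn-prolong : sgn (prolongTo x ε σ) p ≡ sgn x p
    sgn-prolong with compare p (len x)
    ... | tri< _ _ _ = refl
    ... | tri≈ p≮l _ _ = ⊥-elim (p≮l p<l)
    ... | tri> p≮l _ _ = ⊥-elim (p≮l p<l)

  val-prolong-tail : ∀ x {ε σ p} → ¬ p < len x → p ≤O ε →
                     val (prolongTo x ε σ) p ≡ embed σ
  val-prolong-tail x {ε} {σ} {p} p≮l p≤ε =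
    trans (val-< (prolongTo x ε σ) (≤⇒<sucO p≤ε)) (cong embed sgn-prolong)
    where
    sgn-prolong : sgn (prolongTo x ε σ) p ≡ σ
    sgn-prolong with compare p (len x)
    ... | tri< p<l _ _ = ⊥-elim (p≮l p<l)
    ... | tri≈ _ _ _ = refl
    ... | tri> _ _ _ = refl

  append≈prolongTo : ∀ u σ → append u σ ≈ prolongTo u (len u) σ
  append≈prolongTo u σ = ≈-pointwise sgn≗
    where
    sgn≗ : ∀ δ → sgn (append u σ) δ ≡ sgn (prolongTo u (len u) σ) δ
    sgn≗ δ with compare δ (len u)
    ... | tri< _ _ _ = refl
    ... | tri≈ _ _ _ = refl
    ... | tri> _ _ _ = refl

  val-append-< : ∀ u {σ p} → p < len u → val (append u σ) p ≡ val u p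
  val-append-< u {σ} p<l = trans (append≈prolongTo u σ _) (val-prolong-< u (inj₂ refl) p<l)

  val-append-len : ∀ u {σ} → val (append u σ) (len u) ≡ embed σ
  val-append-len u {σ} = trans (append≈prolongTo u σ _) (val-prolong-tail u <-irrefl (inj₂ refl))

  val-append-> : ∀ u {σ p} → len u < p → val (append u σ) p ≡ undef
  val-append-> u {σ} l<p = val-≮ (append u σ) (λ p<sl → ≤⇒≯ (<sucO⇒≤ p<sl) l<p)

  negate : Surreal → Surreal
  negate x = mkS (len x) (λ γ → flipSign (sgn x γ))

  val-negate : ∀ x γ → val (negate x) γ ≡ eflip (val x γ)
  val-negate x γ with compare γ (len x)
  ... | tri< _ _ _ = embed-flipSign (sgn x γ)
  ... | tri≈ _ _ _ = refl
  ... | tri> _ _ _ = refl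

  negate-cong : ∀ {x y γ} → val x γ ≡ val y γ → val (negate x) γ ≡ val (negate y) γ
  negate-cong {x} {y} {γ} e = trans (val-negate x γ) (trans (cong eflip e) (sym (val-negate y γ)))

  negate-cong⁻ : ∀ {x y γ} → val (negate x) γ ≡ val (negate y) γ → val x γ ≡ val y γ
  negate-cong⁻ {x} {y} {γ} e =
    eflip-injective (trans (sym (val-negate x γ)) (trans e (val-negate y γ)))

  Agree-negate : ∀ {x y δ} → Agree x y δ → Agree (negate x) (negate y) δ
  Agree-negate x~y q q<δ = negate-cong (x~y q q<δ)

  Agree-negate⁻ : ∀ {x y δ} → Agree (negate x) (negate y) δ → Agree x y δ
  Agree-negate⁻ x~y q q<δ = negate-cong⁻ (x~y q q<δ)

  negate-≈ : ∀ {x y} → x ≈ y → negate x ≈ negate y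
  negate-≈ x≈y q = negate-cong (x≈y q)

  negate-<ₛ⁻ : ∀ {x y} → negate x <ₛ negate y → y <ₛ x
  negate-<ₛ⁻ {x} {y} (p , x~y , x<y) =
    p , Agree-sym (Agree-negate⁻ x~y) ,
    eflip-<ₑ⁻ (subst₂ _<ₑ_ (val-negate x p) (val-negate y p) x<y)

  negate-<ₛ : ∀ {x y} → x <ₛ y → negate y <ₛ negate x
  negate-<ₛ {x} {y} (p , x~y , x<y) =
    p , Agree-negate (Agree-sym x~y) ,
    subst₂ _<ₑ_ (sym (val-negate y p)) (sym (val-negate x p)) (eflip-<ₑ x<y)

  negate-≤ₛ : ∀ {x y} → x ≤ₛ y → negate y ≤ₛ negate x
  negate-≤ₛ (inj₁ x<y) = inj₁ (negate-<ₛ x<y)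
  negate-≤ₛ (inj₂ x≈y) = inj₂ (negate-≈ (≈-sym x≈y))

  negate-≤ₛ⁻ : ∀ {x y} → negate x ≤ₛ negate y → y ≤ₛ x
  negate-≤ₛ⁻ (inj₁ x<y) = inj₁ (negate-<ₛ⁻ x<y)
  negate-≤ₛ⁻ (inj₂ x≈y) = inj₂ (λ q → negate-cong⁻ (sym (x≈y q)))

  negate-append : ∀ v → negate (append v minus) ≈ append (negate v) plus
  negate-append v = ≈-pointwise sgn≗
    where
    sgn≗ : ∀ δ → sgn (negate (append v minus)) δ ≡ sgn (append (negate v) plus) δ
    sgn≗ δ with compare δ (len v)
    ... | tri< _ _ _ = refl
    ... | tri≈ _ _ _ = refl
    ... | tri> _ _ _ = refl

module Classical (lem : ExcludedMiddle 0ℓ) (O : Ordinals) where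
  open SurrealBasics O public
  open IsStrictTotalOrder isSTO using (_<?_) renaming (trans to <-trans)
  open WF.All wf 0ℓ using (wfRec)

  Least : (Ord → Set) → Ord → Set
  Least P δ = P δ × (∀ e → e < δ → ¬ P e)

  least : (P : Ord → Set) → ∀ {γ} → P γ → Σ Ord (Least P)
  least P {γ} = wfRec (λ γ → P γ → Σ Ord (Least P)) step γ
    where
    step : ∀ γ → WfRec _<_ (λ γ → P γ → Σ Ord (Least P)) γ → P γ → Σ Ord (Least P)
    step γ rec Pγ with lem {Σ Ord λ δ → δ < γ × P δ}
    ... | yes (δ , δ<γ , Pδ) = rec δ<γ Pδ
    ... | no none = γ , Pγ , λ e e<γ Pe → none (e , e<γ , Pe)

  leastDifference : ∀ {x y p} → val x p ≢ val y p → Σ Ord (LeastDiff x y)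
  leastDifference {x} {y} x≢y with least (λ q → val x q ≢ val y q) x≢y
  ... | γ , x≢y-at-γ , agree-below = γ , x≢y-at-γ , λ q q<γ → ≡ₑ-stable (agree-below q q<γ)

  ≤ₛ-or->ₛ : ∀ x y → x ≤ₛ y ⊎ y <ₛ x
  ≤ₛ-or->ₛ x y with lem {Σ Ord λ p → val x p ≢ val y p}
  ... | no none = inj₁ (inj₂ λ p → ≡ₑ-stable λ x≢y → none (p , x≢y))
  ... | yes (_ , x≢y) with leastDifference x≢y
  ...   | γ , x≢y-at-γ , x~y with <ₑ-cmp (val x γ) (val y γ)
  ...     | tri< x<y _ _ = inj₁ (inj₁ (γ , x~y , x<y))
  ...     | tri≈ _ x≡y _ = ⊥-elim (x≢y-at-γ x≡y)
  ...     | tri> _ _ y<x = inj₂ (γ , Agree-sym x~y , y<x)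

  UpperBoundAtPlus : SetS → Surreal → Set
  UpperBoundAtPlus S s =
    ∀ u → S u → Σ Ord λ p → Agree u s p × val s p ≡ eplus × val u p <ₑ eplus

  LowerBoundAtMinus : SetS → Surreal → Set
  LowerBoundAtMinus T t =
    ∀ v → T v → Σ Ord λ p → Agree v t p × val t p ≡ eminus × eminus <ₑ val v p

  CofinalBelow : SetS → Surreal → Set
  CofinalBelow S s = ∀ x δ → Agree x s δ → val x δ <ₑ val s δ → val s δ ≢ undef →
                     Σ Surreal λ u → S u × x ≤ₛ u

  CoinitialAbove : SetS → Surreal → Set
  CoinitialAbove T t = ∀ x δ → Agree x t δ → val t δ <ₑ val x δ → val t δ ≢ undef →
                       Σ Surreal λ v → T v × v ≤ₛ x

  module SupOfMaximum {S : SetS} {s m : Surreal}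
                      (m-max : IsMax S m) (s≈ : s ≈ append m plus) where

    s-below : ∀ {p} → p < len m → val s p ≡ val m p
    s-below p<m = trans (s≈ _) (val-append-< m p<m)

    s-at : val s (len m) ≡ eplus
    s-at = trans (s≈ _) (val-append-len m)

    m-at : val m (len m) ≡ undef
    m-at = val-≮ m <-irrefl

    Agree-m⇒s : ∀ {x p} → p ≤O len m → Agree x m p → Agree x s p
    Agree-m⇒s p≤m x~m q q<p = trans (x~m q q<p) (sym (s-below (<-≤-trans q<p p≤m)))

    upperBound : UpperBoundAtPlus S s
    upperBound u Su with proj₂ m-max u Su
    ... | inj₂ u≈m =
      len m , Agree-m⇒s (inj₂ refl) (λ q _ → u≈m q) , s-at ,
      subst (_<ₑ eplus) (sym (trans (u≈m _) m-at)) u<p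
    ... | inj₁ (p , u~m , u<m) with <-trichotomy p (len m)
    ...   | inj₁ p<m =
      p , Agree-m⇒s (inj₁ p<m) u~m ,
      trans (s-below p<m) (<ₑ-defined⇒eplus u<m (<⇒defined m p<m)) , <ₑ-eplus u<m
    ...   | inj₂ (inj₁ refl) = p , Agree-m⇒s (inj₂ refl) u~m , s-at , <ₑ-eplus u<m
    ...   | inj₂ (inj₂ len<p) = ⊥-elim (<ₑ-irrefl (subst₂ _<ₑ_
            (undefined-upward u (trans (u~m _ len<p) m-at) len<p) (undefined-upward m m-at len<p) u<m))

    below-s⇒≤m : ∀ {x δ} → Agree x s δ → val x δ <ₑ val s δ → val s δ ≢ undef →
                 x ≤ₛ m
    below-s⇒≤m {x} {δ} x~s x<s s-def with <-trichotomy δ (len m)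
    ... | inj₁ δ<m =
      inj₁ (δ , Agree-m δ<m , subst (val x δ <ₑ_) (s-below δ<m) x<s)
      where
      Agree-m : δ < len m → Agree x m δ
      Agree-m δ<m q q<δ = trans (x~s q q<δ) (s-below (<-trans q<δ δ<m))
    ... | inj₂ (inj₁ refl) =
      agree-≤ₛ (λ q q<m → trans (x~s q q<m) (s-below q<m)) m-at
               (λ x+ → eplus-≮ₑ (subst₂ _<ₑ_ x+ s-at x<s))
    ... | inj₂ (inj₂ m<δ) = ⊥-elim (s-def (trans (s≈ _) (val-append-> m m<δ)))

    cofinalBelow : CofinalBelow S s
    cofinalBelow x δ x~s x<s s-def = m , proj₁ m-max , below-s⇒≤m x~s x<s s-def

  module SupWithoutMaximum {S : SetS} {s : Surreal} (noMax : ¬ Σ Surreal (IsMax S))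
      (s-def : ∀ γ → ((val s γ ≡ undef) × ¬ Σ Surreal (λ u → SupWit S u γ))
                     ⊎ Σ Surreal (λ u → SupWit S u γ × val s γ ≡ val u γ)) where

    supWit-unique : ∀ {u u′ γ} → SupWit S u γ → SupWit S u′ γ → val u γ ≡ val u′ γ
    supWit-unique {u} {u′} {γ} (Su , _ , u-stable) (Su′ , _ , u′-stable) with ≤ₛ-or->ₛ u u′
    ... | inj₁ u≤u′ = sym (restrict≈⇒Agree (u-stable u′ Su′ u≤u′) γ (suc-inc γ))
    ... | inj₂ u′<u = restrict≈⇒Agree (u′-stable u Su (inj₁ u′<u)) γ (suc-inc γ)

    val-supWit : ∀ {u γ} → SupWit S u γ → val s γ ≡ val u γ
    val-supWit {u} {γ} wit with s-def γ
    ... | inj₁ (_ , noWit) = ⊥-elim (noWit (u , wit))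
    ... | inj₂ (_ , wit′ , e) = trans e (supWit-unique wit′ wit)

    stable⇒supWit : ∀ {u γ} → S u → val u γ ≢ undef →
                    (∀ w → S w → u ≤ₛ w → Agree w u (sucO γ)) → SupWit S u γ
    stable⇒supWit Su u-def stable = Su , u-def , λ w Sw u≤w → Agree⇒restrict≈ (stable w Sw u≤w)

    supWit-agree : ∀ {u γ} → SupWit S u γ → Agree u s γ
    supWit-agree {u} (Su , u-def , stable) q q<γ =
      sym (val-supWit (stable⇒supWit Su
        (λ u-undef → u-def (undefined-upward u u-undef q<γ))
        (λ w Sw u≤w → Agree-≤ (inj₁ (≤-<-trans (suc-least q _ q<γ) (suc-inc _)))
                                 (restrict≈⇒Agree (stable w Sw u≤w)))))

    cofinalBelow : CofinalBelow S s
    cofinalBelow x δ x~s x<s s-defined with s-def δ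
    ... | inj₁ (s-undef , _) = ⊥-elim (s-defined s-undef)
    ... | inj₂ (u , wit , e) =
      u , proj₁ wit ,
      inj₁ (δ , Agree-trans x~s (Agree-sym (supWit-agree wit)) , subst (val x δ <ₑ_) e x<s)

    exists-above : ∀ {u} → S u → Σ Surreal λ u′ → S u′ × u <ₛ u′
    exists-above {u} Su with lem {Σ Surreal λ u′ → S u′ × u <ₛ u′}
    ... | yes above = above
    ... | no none = ⊥-elim (noMax (u , Su , λ u′ Su′ →
            [ id , (λ u<u′ → ⊥-elim (none (u′ , Su′ , u<u′))) ] (≤ₛ-or->ₛ u′ u)))

    -- g is the first place where some element of S above u departs from u;
    -- s agrees with u below g and carries a plus at g.
    module Deviation {u : Surreal} (Su : S u) where

      Deviates : Ord → Set
      Deviates γ = Σ Surreal λ w → S w × u ≤ₛ w × val w γ ≢ val u γ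

      first : Σ Ord (Least Deviates)
      first with exists-above Su
      ... | u′ , Su′ , u<u′@(p , _ , lt) =
        least Deviates (u′ , Su′ , inj₁ u<u′ , λ e → <ₑ-irrefl (subst (val u p <ₑ_) e lt))

      g : Ord
      g = proj₁ first

      agree-below : ∀ {w} → S w → u ≤ₛ w → Agree w u g
      agree-below Sw u≤w q q<g =
        ≡ₑ-stable λ ne → proj₂ (proj₂ first) q q<g (_ , Sw , u≤w , ne)

      deviation : Deviates g
      deviation = proj₁ (proj₂ first)

      deviator : Surreal
      deviator = proj₁ deviation

      S-deviator : S deviator
      S-deviator = proj₁ (proj₂ deviation)

      u≤deviator : u ≤ₛ deviator
      u≤deviator = proj₁ (proj₂ (proj₂ deviation))

      deviator≢u : val deviator g ≢ val u g
      deviator≢u = proj₂ (proj₂ (proj₂ deviation))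

      u<deviator : val u g <ₑ val deviator g
      u<deviator = ≤ₛ-first-difference u≤deviator (Agree-sym (agree-below S-deviator u≤deviator))
                     (λ e → deviator≢u (sym e))

      u-defined : ∀ {q} → q < g → val u q ≢ undef
      u-defined q<g u-undef = deviator≢u (trans
        (undefined-upward deviator (trans (agree-below S-deviator u≤deviator _ q<g) u-undef) q<g)
        (sym (undefined-upward u u-undef q<g)))

      u~s : Agree u s g
      u~s q q<g = sym (val-supWit (stable⇒supWit Su (u-defined q<g)
        (λ w Sw u≤w → Agree-≤ (suc-least q g q<g) (agree-below Sw u≤w))))

      eplus-witness : ∀ {w} → S w → u ≤ₛ w → val w g ≡ eplus → val s g ≡ eplus
      eplus-witness {w} Sw u≤w w+ =
        trans (val-supWit (stable⇒supWit Sw (val≡embed⇒defined w {σ = plus} w+) stable)) w+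
        where
        w′~w : ∀ {w′} → S w′ → w ≤ₛ w′ → Agree w′ w g
        w′~w Sw′ w≤w′ =
          Agree-trans (agree-below Sw′ (≤ₛ-trans u≤w w≤w′)) (Agree-sym (agree-below Sw u≤w))
        stable : ∀ w′ → S w′ → w ≤ₛ w′ → Agree w′ w (sucO g)
        stable w′ Sw′ w≤w′ q q<sg with <sucO⇒≤ q<sg
        ... | inj₁ q<g = w′~w Sw′ w≤w′ q q<g
        ... | inj₂ refl = trans (≤ₛ-eplus w≤w′ (Agree-sym (w′~w Sw′ w≤w′)) w+) (sym w+)

      eplus-above-u : Σ Surreal λ w → S w × u ≤ₛ w × val w g ≡ eplus
      eplus-above-u with val deviator g in d-at
      ... | eplus = deviator , S-deviator , u≤deviator , d-at
      ... | eminus = ⊥-elim (≮ₑ-eminus (subst (val u g <ₑ_) d-at u<deviator))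
      ... | undef with exists-above S-deviator
      ...   | u″ , Su″ , d<u″ =
        u″ , Su″ , u≤u″ , undef-<ₑ (subst (_<ₑ val u″ g) d-at
          (≤ₛ-first-difference (inj₁ d<u″) d~u″ λ d≡u″ → <ₛ-irrefl
            (<ₛ-respˡ-≈ (agree-undefined⇒≈ d~u″ d-at (trans (sym d≡u″) d-at)) d<u″)))
        where
        u≤u″ : u ≤ₛ u″
        u≤u″ = inj₁ (≤ₛ-<ₛ-trans u≤deviator d<u″)
        d~u″ : Agree deviator u″ g
        d~u″ = Agree-trans (agree-below S-deviator u≤deviator) (Agree-sym (agree-below Su″ u≤u″))

    upperBound : UpperBoundAtPlus S s
    upperBound u Su with Deviation.eplus-above-u Su
    ... | w , Sw , u≤w , w+ = g , u~s , eplus-witness Sw u≤w w+ , <ₑ-eplus u<deviator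
      where open Deviation Su

  supStar-bounds : ∀ {S s} → IsSupStar S s → UpperBoundAtPlus S s × CofinalBelow S s
  supStar-bounds (inj₁ (m , m-max , s≈)) =
    SupOfMaximum.upperBound m-max s≈ , SupOfMaximum.cofinalBelow m-max s≈
  supStar-bounds (inj₂ (noMax , s-def)) =
    SupWithoutMaximum.upperBound noMax s-def , SupWithoutMaximum.cofinalBelow noMax s-def

  -- Not T (negate u): negate is an involution only up to ≈, and T need not
  -- respect ≈.
  Negated : SetS → SetS
  Negated T u = Σ Surreal λ v → T v × u ≈ negate v

  module InfAsNegatedSup {T : SetS} where

    isMin⇒isMax : ∀ {v} → IsMin T v → IsMax (Negated T) (negate v)
    isMin⇒isMax (Tv , v-min) =
      (_ , Tv , ≈-refl) ,
      λ { u (v′ , Tv′ , u≈) → ≤ₛ-trans (inj₂ u≈) (negate-≤ₛ (v-min v′ Tv′)) }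

    isMax⇒isMin : ∀ {u} → IsMax (Negated T) u → Σ Surreal (IsMin T)
    isMax⇒isMin ((v , Tv , u≈) , u-max) =
      v , Tv , λ v′ Tv′ → negate-≤ₛ⁻ (≤ₛ-trans (u-max _ (v′ , Tv′ , ≈-refl)) (inj₂ u≈))

    infWit⇒supWit : ∀ {v γ} → InfWit T v γ → SupWit (Negated T) (negate v) γ
    infWit⇒supWit {v} {γ} (Tv , v-def , v-stable) =
      (v , Tv , ≈-refl) , (λ e → v-def (eflip-injective (trans (sym (val-negate v γ)) e))) , stable
      where
      stable : ∀ u → Negated T u → negate v ≤ₛ u → restrict≤ u γ ≈ restrict≤ (negate v) γ
      stable u (v′ , Tv′ , u≈) v≤u = Agree⇒restrict≈ (Agree-trans (λ q _ → u≈ q)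
        (Agree-negate (restrict≈⇒Agree
          (v-stable v′ Tv′ (negate-≤ₛ⁻ (≤ₛ-trans v≤u (inj₂ u≈)))))))

    supWit⇒infWit : ∀ {u γ} → SupWit (Negated T) u γ → Σ Surreal λ v → InfWit T v γ
    supWit⇒infWit {u} {γ} ((v , Tv , u≈) , u-def , u-stable) =
      v , Tv , (λ e → u-def (trans (u≈ γ) (trans (val-negate v γ) (cong eflip e)))) , stable
      where
      stable : ∀ v′ → T v′ → v′ ≤ₛ v → restrict≤ v′ γ ≈ restrict≤ v γ
      stable v′ Tv′ v′≤v = Agree⇒restrict≈ (Agree-negate⁻ (Agree-respʳ-≈ u≈
        (restrict≈⇒Agree
          (u-stable _ (v′ , Tv′ , ≈-refl) (≤ₛ-trans (inj₂ u≈) (negate-≤ₛ v′≤v))))))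

    infStar⇒supStar : ∀ {t} → IsInfStar T t → IsSupStar (Negated T) (negate t)
    infStar⇒supStar (inj₁ (v , v-min , t≈)) =
      inj₁ (negate v , isMin⇒isMax v-min , ≈-trans (negate-≈ t≈) (negate-append v))
    infStar⇒supStar {t} (inj₂ (noMin , t-def)) =
      inj₂ ((λ (u , u-max) → noMin (isMax⇒isMin u-max)) ,
            λ γ → ⊎-map undefined defined (t-def γ))
      where
      undefined : ∀ {γ} → (val t γ ≡ undef) × ¬ Σ Surreal (λ v → InfWit T v γ) →
                  (val (negate t) γ ≡ undef) × ¬ Σ Surreal (λ u → SupWit (Negated T) u γ)
      undefined {γ} (t-undef , noWit) =
        trans (val-negate t γ) (cong eflip t-undef) , λ (_ , wit) → noWit (supWit⇒infWit wit)
      defined : ∀ {γ} → Σ Surreal (λ v → InfWit T v γ × val t γ ≡ val v γ) →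
                Σ Surreal (λ u → SupWit (Negated T) u γ × val (negate t) γ ≡ val u γ)
      defined (v , wit , e) = negate v , infWit⇒supWit wit , negate-cong e

    upperBound⇒lowerBound : ∀ {t} → UpperBoundAtPlus (Negated T) (negate t) → LowerBoundAtMinus T t
    upperBound⇒lowerBound {t} ub v Tv with ub (negate v) (v , Tv , ≈-refl)
    ... | p , v~t , t+ , v<+ =
      p , Agree-negate⁻ v~t , eflip-injective (trans (sym (val-negate t p)) t+) ,
      eflip-<ₑ⁻ (subst (_<ₑ eplus) (val-negate v p) v<+)

    cofinal⇒coinitial : ∀ {t} → CofinalBelow (Negated T) (negate t) → CoinitialAbove T t
    cofinal⇒coinitial {t} cof x δ x~t t<x t-def
      with cof (negate x) δ (Agree-negate x~t)
             (subst₂ _<ₑ_ (sym (val-negate x δ)) (sym (val-negate t δ)) (eflip-<ₑ t<x))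
             (λ e → t-def (eflip-injective (trans (sym (val-negate t δ)) e)))
    ... | u , (v , Tv , u≈) , x≤u = v , Tv , negate-≤ₛ⁻ (≤ₛ-trans x≤u (inj₂ u≈))

  infStar-bounds : ∀ {T t} → IsInfStar T t → LowerBoundAtMinus T t × CoinitialAbove T t
  infStar-bounds t-inf with supStar-bounds (InfAsNegatedSup.infStar⇒supStar t-inf)
  ... | ub , cof = InfAsNegatedSup.upperBound⇒lowerBound ub , InfAsNegatedSup.cofinal⇒coinitial cof

  upperBound-prolong : ∀ {S s ε σ} → len s ≤O ε →
                       UpperBoundAtPlus S s → UpperBoundAtPlus S (prolongTo s ε σ)
  upperBound-prolong {s = s} α≤ε ub u Su with ub u Su
  ... | p , u~s , s+ , u<+ =
    p , Agree-trans u~s (λ q q<p → sym (val-prolong-< s α≤ε (<-trans q<p p<α))) ,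
    trans (val-prolong-< s α≤ε p<α) s+ , u<+
    where
    p<α : p < len s
    p<α = val≡embed⇒< s {σ = plus} s+

  lowerBound-prolong : ∀ {T t ε σ} → len t ≤O ε →
                       LowerBoundAtMinus T t → LowerBoundAtMinus T (prolongTo t ε σ)
  lowerBound-prolong {t = t} β≤ε lb v Tv with lb v Tv
  ... | p , v~t , t- , -<v =
    p , Agree-trans v~t (λ q q<p → sym (val-prolong-< t β≤ε (<-trans q<p p<β))) ,
    trans (val-prolong-< t β≤ε p<β) t- , -<v
    where
    p<β : p < len t
    p<β = val≡embed⇒< t {σ = minus} t-

  cofinalBelow-prolong : ∀ {S s ε} → len s ≤O ε →
                         CofinalBelow S s → CofinalBelow S (prolongTo s ε minus)
  cofinalBelow-prolong {s = s} α≤ε cof x δ x~ŝ x<ŝ ŝ-def with δ <? len s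
  ... | yes δ<α =
    cof x δ (λ q q<δ → trans (x~ŝ q q<δ) (val-prolong-< s α≤ε (<-trans q<δ δ<α)))
          (subst (val x δ <ₑ_) (val-prolong-< s α≤ε δ<α) x<ŝ) (<⇒defined s δ<α)
  ... | no δ≮α = ⊥-elim (≮ₑ-eminus (subst (val x δ <ₑ_)
          (val-prolong-tail s δ≮α (<sucO⇒≤ (defined⇒< _ ŝ-def))) x<ŝ))

  coinitialAbove-prolong : ∀ {T t ε} → len t ≤O ε →
                           CoinitialAbove T t → CoinitialAbove T (prolongTo t ε plus)
  coinitialAbove-prolong {t = t} β≤ε coi x δ x~t̂ t̂<x t̂-def with δ <? len t
  ... | yes δ<β =
    coi x δ (λ q q<δ → trans (x~t̂ q q<δ) (val-prolong-< t β≤ε (<-trans q<δ δ<β)))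
          (subst (_<ₑ val x δ) (val-prolong-< t β≤ε δ<β) t̂<x) (<⇒defined t δ<β)
  ... | no δ≮β = ⊥-elim (eplus-≮ₑ (subst (_<ₑ val x δ)
          (val-prolong-tail t δ≮β (<sucO⇒≤ (defined⇒< _ t̂-def))) t̂<x))

  upperBound⇒< : ∀ {S a u} → UpperBoundAtPlus S a → S u → u <ₛ a
  upperBound⇒< {u = u} ub Su with ub u Su
  ... | p , u~a , a+ , u<+ = p , u~a , subst (val u p <ₑ_) (sym a+) u<+

  lowerBound⇒> : ∀ {T b v} → LowerBoundAtMinus T b → T v → b <ₛ v
  lowerBound⇒> {v = v} lb Tv with lb v Tv
  ... | p , v~b , b- , -<v = p , Agree-sym v~b , subst (_<ₑ val v p) (sym b-) -<v

  upperBound-above : ∀ {S a x γ u} → UpperBoundAtPlus S a → Agree x a γ →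
                     val a γ ≡ eminus → val x γ ≢ eminus → S u → u <ₛ x
  upperBound-above {x = x} {γ} {u} ub x~a a- x≢- Su with ub u Su
  ... | p , u~a , a+ , u<+ with <-trichotomy p γ
  ...   | inj₁ p<γ =
    p , Agree-trans u~a (Agree-sym (Agree-≤ (inj₁ p<γ) x~a)) ,
    subst (val u p <ₑ_) (sym (trans (x~a p p<γ) a+)) u<+
  ...   | inj₂ (inj₁ refl) = ⊥-elim (eminus≢eplus (trans (sym a-) a+))
  ...   | inj₂ (inj₂ γ<p) =
    γ , Agree-trans (Agree-≤ (inj₁ γ<p) u~a) (Agree-sym x~a) ,
    subst (_<ₑ val x γ) (sym (trans (u~a γ γ<p) a-)) (≢eminus⇒eminus<ₑ x≢-)

  lowerBound-below : ∀ {T b x γ v} → LowerBoundAtMinus T b → Agree x b γ →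
                     val b γ ≡ eplus → val x γ ≢ eplus → T v → x <ₛ v
  lowerBound-below {x = x} {γ} {v} lb x~b b+ x≢+ Tv with lb v Tv
  ... | p , v~b , b- , -<v with <-trichotomy p γ
  ...   | inj₁ p<γ =
    p , Agree-trans (Agree-≤ (inj₁ p<γ) x~b) (Agree-sym v~b) ,
    subst (_<ₑ val v p) (sym (trans (x~b p p<γ) b-)) -<v
  ...   | inj₂ (inj₁ refl) = ⊥-elim (eminus≢eplus (trans (sym b-) b+))
  ...   | inj₂ (inj₂ γ<p) =
    γ , Agree-trans x~b (Agree-sym (Agree-≤ (inj₁ γ<p) v~b)) ,
    subst (val x γ <ₑ_) (sym (trans (v~b γ γ<p) b+)) (≢eplus⇒<ₑeplus x≢+)

  module Gap {S T : SetS} (S<T : ∀ u v → S u → T v → u <ₛ v)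
             {a b : Surreal} (len-a≡len-b : len a ≡ len b)
             (a-ub : UpperBoundAtPlus S a) (a-cof : CofinalBelow S a)
             (b-lb : LowerBoundAtMinus T b) (b-coi : CoinitialAbove T b) where

    leastDiff-< : ∀ {γ} → LeastDiff a b γ → γ < len a
    leastDiff-< {γ} (a≢b , _) with γ <? len a
    ... | yes γ<a = γ<a
    ... | no γ≮a = ⊥-elim (a≢b (trans (val-≮ a γ≮a)
                     (sym (val-≮ b (subst (λ l → ¬ γ < l) len-a≡len-b γ≮a)))))

    no-plus-minus : ∀ {γ} → Agree a b γ → val a γ ≡ eplus → val b γ ≡ eminus → ⊥
    no-plus-minus {γ} a~b a+ b-
      with a-cof (restrict a γ) γ (restrict-agree a)
             (subst₂ _<ₑ_ (sym (restrict-undefined a)) (sym a+) u<p)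
             (val≡embed⇒defined a {σ = plus} a+)
         | b-coi (restrict a γ) γ (Agree-trans (restrict-agree a) a~b)
             (subst₂ _<ₑ_ (sym b-) (sym (restrict-undefined a)) m<u)
             (val≡embed⇒defined b {σ = minus} b-)
    ... | u , Su , c≤u | v , Tv , v≤c = ≤ₛ⇒≯ (≤ₛ-trans v≤c c≤u) (S<T u v Su Tv)

    module AtLeastDiff {γ : Ord} (d : LeastDiff a b γ) where

      a~b : Agree a b γ
      a~b = proj₂ d

      γ<a : γ < len a
      γ<a = leastDiff-< d

      signs : val a γ ≡ eminus × val b γ ≡ eplus
      signs = [ id , (λ (a+ , b-) → ⊥-elim (no-plus-minus a~b a+ b-)) ]
        (opposite-signs (val a γ) (val b γ) (<⇒defined a γ<a)
          (<⇒defined b (subst (γ <_) len-a≡len-b γ<a)) (proj₁ d))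

      a- : val a γ ≡ eminus
      a- = proj₁ signs

      b+ : val b γ ≡ eplus
      b+ = proj₂ signs

      a-separates : Separates S T a
      a-separates = (λ u Su → upperBound⇒< a-ub Su) ,
                    (λ v Tv → lowerBound-below b-lb a~b b+
                                (λ e → eminus≢eplus (trans (sym a-) e)) Tv)

      b-separates : Separates S T b
      b-separates =
        (λ u Su → upperBound-above a-ub (Agree-sym a~b) a-
                    (λ e → eminus≢eplus (trans (sym e) b+)) Su) ,
        (λ v Tv → lowerBound⇒> b-lb Tv)

      a<b : a <ₛ b
      a<b = γ , a~b , subst₂ _<ₑ_ (sym a-) (sym b+) m<p

      restrict-separates : Separates S T (restrict a γ)
      restrict-separates =
        (λ u Su → upperBound-above a-ub (restrict-agree a) a-
                    (λ e → undef≢eminus (trans (sym (restrict-undefined a)) e)) Su) ,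
        (λ v Tv → lowerBound-below b-lb (Agree-trans (restrict-agree a) a~b) b+
                    (λ e → undef≢eplus (trans (sym (restrict-undefined a)) e)) Tv)

      separator-agrees : ∀ {w} → Separates S T w → Agree w a γ
      separator-agrees {w} (S<w , w<T) q = wfRec (λ q → q < γ → val w q ≡ val a q) step q
        where
        agree-next : ∀ {q} → q < γ → Agree w a q → val w q ≡ val a q
        agree-next {q} q<γ w~a with <ₑ-cmp (val w q) (val a q)
        ... | tri≈ _ w≡a _ = w≡a
        ... | tri< w<a _ _ with a-cof w q w~a w<a (<⇒defined a (<-trans q<γ γ<a))
        ...   | u , Su , w≤u = ⊥-elim (≤ₛ⇒≯ w≤u (S<w u Su))
        agree-next {q} q<γ w~a | tri> _ _ a<w
          with b-coi w q (Agree-trans w~a (Agree-≤ (inj₁ q<γ) a~b))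
                 (subst (_<ₑ val w q) (a~b q q<γ) a<w)
                 (subst (_≢ undef) (a~b q q<γ) (<⇒defined a (<-trans q<γ γ<a)))
        ...   | v , Tv , v≤w = ⊥-elim (≤ₛ⇒≯ v≤w (w<T v Tv))
        step : ∀ q → WfRec _<_ (λ q → q < γ → val w q ≡ val a q) q →
               q < γ → val w q ≡ val a q
        step q rec q<γ = agree-next q<γ (λ r r<q → rec r<q (<-trans r<q q<γ))

    closest : ∀ γ → LeastDiff a b γ →
              restrict a γ ≈ restrict b γ
              × Separates S T (restrict a γ)
              × (∀ w → Separates S T w → len (restrict a γ) ≤O len w)
              × (∀ w → Separates S T w → Prolongment w (restrict a γ))
    closest γ d = Agree⇒restrict≈ a~b , restrict-separates , shortest , prolonged
      where
      open AtLeastDiff d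
      shortest : ∀ w → Separates S T w → len (restrict a γ) ≤O len w
      shortest w w-sep = ≤O-trans (minO-≤ˡ γ (len a)) (≮⇒≥ λ w<γ →
        <⇒defined a (<-trans w<γ γ<a)
          (trans (sym (separator-agrees w-sep (len w) w<γ)) (val-≮ w <-irrefl)))
      prolonged : ∀ w → Separates S T w → Prolongment w (restrict a γ)
      prolonged w w-sep = γ , Agree⇒restrict≈ (Agree-sym (separator-agrees w-sep))

    separation : ∀ {p} → val a p ≢ val b p → Separates S T a × Separates S T b × a <ₛ b
    separation a≢b = a-separates , b-separates , a<b
      where open AtLeastDiff (proj₂ (leastDifference a≢b))

theorem5p3 : ExcludedMiddle 0ℓ → (O : Ordinals) →
    let open Surreals O in
    (S T : SetS) →
    (∀ u v → S u → T v → u <ₛ v) →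
    (s t : Surreal) → IsSupStar S s → IsInfStar T t →
    let ε = maxO (len s) (len t)
        ŝ = prolongTo s ε minus
        t̂ = prolongTo t ε plus
    in Separates S T ŝ × Separates S T t̂ × ŝ <ₛ t̂ ×
       (∀ γ → LeastDiff ŝ t̂ γ →
          restrict ŝ γ ≈ restrict t̂ γ
          × Separates S T (restrict ŝ γ)
          × (∀ w → Separates S T w → len (restrict ŝ γ) ≤O len w)
          × (∀ w → Separates S T w → Prolongment w (restrict ŝ γ)))
theorem5p3 lem O S T S<T s t s-sup t-inf =
  let (ŝ-separates , t̂-separates , ŝ<t̂) = separation ŝ≢t̂ in
  ŝ-separates , t̂-separates , ŝ<t̂ , closest
  where
  open Classical lem O
  ε : Ord
  ε = maxO (len s) (len t)
  α≤ε : len s ≤O ε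
  α≤ε = maxO-≥ˡ (len s) (len t)
  β≤ε : len t ≤O ε
  β≤ε = maxO-≥ʳ (len s) (len t)
  open Gap S<T {prolongTo s ε minus} {prolongTo t ε plus} refl
    (upperBound-prolong α≤ε (proj₁ (supStar-bounds s-sup)))
    (cofinalBelow-prolong α≤ε (proj₂ (supStar-bounds s-sup)))
    (lowerBound-prolong β≤ε (proj₁ (infStar-bounds t-inf)))
    (coinitialAbove-prolong β≤ε (proj₂ (infStar-bounds t-inf)))
  ŝ≢t̂ : val (prolongTo s ε minus) ε ≢ val (prolongTo t ε plus) ε
  ŝ≢t̂ ŝ≡t̂ = eminus≢eplus (trans (sym (val-prolong-tail s (≤⇒≯ α≤ε) (inj₂ refl)))
                                (trans ŝ≡t̂ (val-prolong-tail t (≤⇒≯ β≤ε) (inj₂ refl))))
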